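{- Let $w\in\{a,b\}^+$ be an open Sturmian word. Then $S^l(w)=K_w$ and $S^r(w)=H_w$.
   Context: A finite word over $\{a,b\}$ is Sturmian if it is a factor of some Sturmian infinite word (an infinite binary word with exactly $n+1$ distinct factors of each length $n$). A word $u$ is closed if $u$ is a single letter or $u$ contains exactly two occurrences of some nonempty proper factor, one as a prefix and one as a suffix; otherwise it is open. $H_w$ (resp. $K_w$) is the length of the shortest prefix (resp. suffix) of $w$ that occurs only once in $w$. $S^l(w)$ (resp. $S^r(w)$) is the number of distinct left (resp. right) special factors of $w$, where $v$ is left special in $w$ if $av$ and $bv$ are both factors of $w$ (right special: $va$ and $vb$ both factors), and the empty word counts as both left and right special. -}

module Defs where

open import Data.Nat using (ℕ; zero; suc; _+_; _∸_; _<_)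
open import Data.List using (List; []; _∷_; _++_; [_]; length; map; upTo; take; drop)
open import Data.List.Membership.Propositional using (_∈_)
open import Data.List.Relation.Unary.Unique.Propositional using (Unique)
open import Data.Product using (Σ; ∃; ∃-syntax; _×_; _,_)
open import Data.Sum using (_⊎_)
open import Relation.Nullary using (¬_)
open import Relation.Binary.PropositionalEquality using (_≡_; _≢_)
open import Function.Bundles using (_⇔_)

data Letter : Set where
  a b : Letter

Word : Set
Word = List Letter

OccursAt : Word → Word → ℕ → Set
OccursAt v u i = ∃[ x ] ∃[ y ] (length x ≡ i × x ++ v ++ y ≡ u)

Factor : Word → Word → Set
Factor v u = ∃[ i ] OccursAt v u i

OccursOnce : Word → Word → Set
OccursOnce v u = Factor v u × (∀ i j → OccursAt v u i → OccursAt v u j → i ≡ j)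

InfWord : Set
InfWord = ℕ → Letter

window : InfWord → ℕ → ℕ → Word
window x i n = map (λ j → x (i + j)) (upTo n)

SturmianInf : InfWord → Set
SturmianInf x = ∀ n → ∃[ L ] (length L ≡ suc n × Unique L ×
                  (∀ v → v ∈ L ⇔ (∃[ i ] window x i n ≡ v)))

Sturmian : Word → Set
Sturmian w = ∃[ x ] (SturmianInf x × ∃[ i ] window x i (length w) ≡ w)

Closed : Word → Set
Closed u = length u ≡ 1
         ⊎ ∃[ v ] (v ≢ [] × length v < length u ×
                   OccursAt v u 0 × OccursAt v u (length u ∸ length v) ×
                   (∀ i → OccursAt v u i → i ≡ 0 ⊎ i ≡ length u ∸ length v))

Open : Word → Set
Open u = ¬ Closed u

-- H_w and K_w (given as relations: "h is H_w", "k is K_w")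

IsH : Word → ℕ → Set
IsH w h = OccursOnce (take h w) w × (∀ k → k < h → ¬ OccursOnce (take k w) w)

IsK : Word → ℕ → Set
IsK w k = OccursOnce (drop (length w ∸ k) w) w
        × (∀ j → j < k → ¬ OccursOnce (drop (length w ∸ j) w) w)

-- Special factors (the empty word counts as both left and right special)

LeftSpecial : Word → Word → Set
LeftSpecial w v = v ≡ [] ⊎ (Factor (a ∷ v) w × Factor (b ∷ v) w)

RightSpecial : Word → Word → Set
RightSpecial w v = v ≡ [] ⊎ (Factor (v ++ [ a ]) w × Factor (v ++ [ b ]) w)

-- L is a duplicate-free enumeration of the words satisfying P;
-- then length L is the number of such words.
Enumerates : (Word → Set) → List Word → Set
Enumerates P L = Unique L × (∀ v → v ∈ L ⇔ P v)

module Submission where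

open import Defs
open import Data.Nat using (ℕ; zero; suc; _+_; _∸_; _≤_; _<_; _≤?_; _<?_; z≤n; s≤s)
open import Data.Nat.Properties
open import Data.List using (List; []; _∷_; _++_; [_]; length; map; filter; applyUpTo; take; drop; reverse)
open import Data.List.Properties using (≡-dec; length-++; length-take; length-drop; take++drop≡id; take-all; ∷ʳ-++; ++-assoc; reverse-++; reverse-involutive; reverse-injective; length-reverse; unfold-reverse; ++-identityʳ; ∷-injective; ∷-injectiveˡ; ∷-injectiveʳ; ∷ʳ-injective; map-applyUpTo; length-map; filter-notAll)
open import Data.List.Membership.Propositional using (_∈_; _∉_)
open import Data.List.Membership.Propositional.Properties using (∈-filter⁺; ∈-filter⁻; ∈-map⁺; ∈-map⁻)
open import Data.List.Relation.Unary.Any as Any using (here; there)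
open import Data.List.Relation.Unary.All as All using (All; []; _∷_)
open import Data.List.Relation.Unary.All.Properties using (All¬⇒¬Any)
open import Data.List.Relation.Unary.AllPairs using ([]; _∷_)
open import Data.List.Relation.Unary.Unique.Propositional using (Unique)
open import Data.List.Relation.Unary.Unique.Propositional.Properties using (filter⁺; map⁺)
open import Data.Product using (Σ; ∃-syntax; _×_; _,_; proj₁; proj₂)
open import Data.Empty using (⊥; ⊥-elim)
open import Data.Sum using (_⊎_; inj₁; inj₂)
open import Function using (_∘_)
open import Function.Bundles using (Equivalence; _⇔_; mk⇔)
open import Relation.Nullary using (Dec; ¬_; ¬?; yes; no)
open import Relation.Nullary.Decidable using (decidable-stable; _×-dec_)
open import Relation.Binary.Definitions using (DecidableEquality)
open import Relation.Binary.PropositionalEquality using (_≡_; _≢_; refl; sym; trans; cong; cong₂; subst; subst₂; module ≡-Reasoning)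

-- The argument has three parts.
-- (1) A Sturmian infinite word x has n + 1 factors of length n, and every factor extends
--     to the right (to the left as well, once one knows that every prefix of x recurs).
--     Counting extensions (module Extensions) shows that two distinct right (left) special
--     factors of the same length would give n + 3 factors of length n + 1.  Recurrence of
--     prefixes is itself proved by counting, in the double-negated form that suffices.
--     Hence a finite Sturmian word has at most one right and one left special factor of
--     each length.
-- (2) Let w be nonempty and open, with at most one right special factor per length.  Write
--     w = p c r where p c is the shortest prefix occurring once.  Openness forces p to be
--     right special, no right special factor is longer than p, and so the right special
--     factors are exactly the suffixes of p: there are |p| + 1 = H_w of them.
-- (3) Reversal exchanges left and right special factors, maps K_w to H of the reversal and
--     preserves openness, so the left count follows from (2) applied to reverse w.

_≟ᴸ_ : DecidableEquality Letter
a ≟ᴸ a = yes refl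
a ≟ᴸ b = no λ ()
b ≟ᴸ a = no λ ()
b ≟ᴸ b = yes refl

_≟ᵂ_ : DecidableEquality Word
_≟ᵂ_ = ≡-dec _≟ᴸ_

a≢b : a ≢ b
a≢b ()

open import Data.List.Membership.DecPropositional _≟ᵂ_ using (_∈?_)

bothLetters : ∀ (F : Letter → Set) {c c'} → c ≢ c' → F c → F c' → F a × F b
bothLetters F {a} {a} c≢c' _  _  = ⊥-elim (c≢c' refl)
bothLetters F {a} {b} _    fa fb = fa , fb
bothLetters F {b} {a} _    fb fa = fa , fb
bothLetters F {b} {b} c≢c' _  _  = ⊥-elim (c≢c' refl)

everyLetter : ∀ (F : Letter → Set) → F a → F b → ∀ c → F c
everyLetter F fa fb a = fa
everyLetter F fa fb b = fb

snoc-injective : ∀ {c c' : Letter} {z z' : Word} → z ++ [ c ] ≡ z' ++ [ c' ] → c ≡ c' × z ≡ z'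
snoc-injective {z = z} {z'} e = let (z≡z' , c≡c') = ∷ʳ-injective z z' e in c≡c' , z≡z'

length-snoc : ∀ (u : Word) c → length (u ++ [ c ]) ≡ suc (length u)
length-snoc u c = trans (length-++ u) (+-comm (length u) 1)

length-++₃ : ∀ (xs v ys : Word) → length (xs ++ v ++ ys) ≡ length xs + length v + length ys
length-++₃ xs v ys = trans (length-++ xs) (trans (cong (length xs +_) (length-++ v)) (sym (+-assoc (length xs) _ _)))

++-split : ∀ (p q : Word) {r s} → length p ≡ length q → p ++ r ≡ q ++ s → p ≡ q × r ≡ s
++-split []      []      _ e = refl , e
++-split (c ∷ p) (d ∷ q) l e with ∷-injective e
... | refl , e' = let (p≡q , r≡s) = ++-split p q (suc-injective l) e' in cong (c ∷_) p≡q , r≡s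

take-length-++ : ∀ (p s : Word) → take (length p) (p ++ s) ≡ p
take-length-++ []      s = refl
take-length-++ (c ∷ p) s = cong (c ∷_) (take-length-++ p s)

drop-length-++ : ∀ (p s : Word) → drop (length p) (p ++ s) ≡ s
drop-length-++ []      s = refl
drop-length-++ (c ∷ p) s = drop-length-++ p s

empty-by-length : ∀ {u : Word} → length u ≡ 0 → u ≡ []
empty-by-length {[]} _ = refl

module Counting {A : Set} (_≟_ : DecidableEquality A) where

  _without_ : List A → A → List A
  Y without x = filter (λ z → ¬? (z ≟ x)) Y

  without-shorter : ∀ {x Y} → x ∈ Y → length (Y without x) < length Y
  without-shorter {x} {Y} x∈Y =
    filter-notAll (λ z → ¬? (z ≟ x)) Y (Any.map (λ x≡z z≢x → z≢x (sym x≡z)) x∈Y)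

  without-keeps : ∀ {x z Y} → z ∈ Y → z ≢ x → z ∈ Y without x
  without-keeps {x} z∈Y z≢x = ∈-filter⁺ (λ z → ¬? (z ≟ x)) z∈Y z≢x

  pigeonhole : ∀ {X Y} → Unique X → (∀ {z} → z ∈ X → z ∈ Y) → length X ≤ length Y
  pigeonhole {[]}    _           _    = z≤n
  pigeonhole {x ∷ X} {Y} (x∉X ∷ uX) X⊆Y =
    ≤-trans (s≤s (pigeonhole uX X⊆Y-x)) (without-shorter (X⊆Y (here refl)))
    where
      X⊆Y-x : ∀ {z} → z ∈ X → z ∈ Y without x
      X⊆Y-x z∈X = without-keeps (X⊆Y (there z∈X)) (λ z≡x → All.lookup x∉X z∈X (sym z≡x))

  without-member : ∀ {x z Y} → z ∈ Y without x → z ∈ Y × z ≢ x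
  without-member {x} = ∈-filter⁻ (λ z → ¬? (z ≟ x))

  without-length : ∀ {x Y} → Unique Y → x ∈ Y → suc (length (Y without x)) ≡ length Y
  without-length {x} {Y} uY x∈Y = ≤-antisym (without-shorter x∈Y) (pigeonhole uY inWithout)
    where
      inWithout : ∀ {z} → z ∈ Y → z ∈ x ∷ Y without x
      inWithout {z} z∈Y with z ≟ x
      ... | yes z≡x = here z≡x
      ... | no  z≢x = there (without-keeps z∈Y z≢x)

  sameLength : ∀ {X Y} → Unique X → Unique Y →
               (∀ {z} → z ∈ X → z ∈ Y) → (∀ {z} → z ∈ Y → z ∈ X) → length X ≡ length Y
  sameLength uX uY X⊆Y Y⊆X = ≤-antisym (pigeonhole uX X⊆Y) (pigeonhole uY Y⊆X)

  AtLeast : ℕ → (A → Set) → Set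
  AtLeast m P = Σ (List A) λ Y → Unique Y × length Y ≡ m × (∀ {y} → y ∈ Y → P y)

  atLeast-bound : ∀ {m P L} → AtLeast m P → (∀ {y} → P y → y ∈ L) → m ≤ length L
  atLeast-bound (Y , uY , refl , PY) P⊆L = pigeonhole uY (P⊆L ∘ PY)

  atLeast-bound-missing : ∀ {m P L z} → AtLeast m P → (∀ {y} → P y → y ∈ L) → z ∈ L → ¬ P z →
                          suc m ≤ length L
  atLeast-bound-missing {P = P} {z = z} (Y , uY , refl , PY) P⊆L z∈L ¬Pz =
    pigeonhole (All.tabulate (λ y∈Y z≡y → ¬Pz (subst P (sym z≡y) (PY y∈Y))) ∷ uY)
               λ { (here refl) → z∈L ; (there y∈Y) → P⊆L (PY y∈Y) }

  atLeast-map : ∀ {m} {P Q : A → Set} (g : A → A) →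
                (∀ {y y'} → P y → P y' → g y ≡ g y' → y ≡ y') → (∀ {y} → P y → Q (g y)) →
                AtLeast m P → AtLeast m Q
  atLeast-map {P = P} {Q} g inj PQ (Y , uY , refl , PY) =
    map g Y , map-unique uY PY , length-map g Y , image
    where
      map-unique : ∀ {Y} → Unique Y → (∀ {y} → y ∈ Y → P y) → Unique (map g Y)
      map-unique []         _  = []
      map-unique (y∉Y ∷ uY) PY =
        All.tabulate (λ t∈gY gy≡t → let (y' , y'∈Y , t≡gy') = ∈-map⁻ g t∈gY in
                        All.lookup y∉Y y'∈Y (inj (PY (here refl)) (PY (there y'∈Y)) (trans gy≡t t≡gy')))
        ∷ map-unique uY (PY ∘ there)
      image : ∀ {t} → t ∈ map g Y → Q t
      image t∈gY with ∈-map⁻ g t∈gY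
      ... | _ , y∈Y , refl = PQ (PY y∈Y)

open Counting _≟ᵂ_

segment : InfWord → ℕ → ℕ → Word
segment x i zero    = []
segment x i (suc n) = x i ∷ segment x (suc i) n

window≡segment : ∀ x i n → window x i n ≡ segment x i n
window≡segment x i n = trans (map-applyUpTo (λ j → j) (λ j → x (i + j)) n) (applyUpTo≡segment n (λ j → refl))
  where
    applyUpTo≡segment : ∀ {i} n {f : ℕ → Letter} → (∀ j → f j ≡ x (i + j)) → applyUpTo f n ≡ segment x i n
    applyUpTo≡segment zero    f≗ = refl
    applyUpTo≡segment {i} (suc n) f≗ =
      cong₂ _∷_ (trans (f≗ 0) (cong x (+-identityʳ i)))
                (applyUpTo≡segment n (λ j → trans (f≗ (suc j)) (cong x (+-suc i j))))

length-segment : ∀ x i n → length (segment x i n) ≡ n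
length-segment x i zero    = refl
length-segment x i (suc n) = cong suc (length-segment x (suc i) n)

segment-+ : ∀ x i m n → segment x i (m + n) ≡ segment x i m ++ segment x (i + m) n
segment-+ x i zero    n = cong (λ k → segment x k n) (sym (+-identityʳ i))
segment-+ x i (suc m) n =
  cong (x i ∷_) (trans (segment-+ x (suc i) m n) (cong (λ k → segment x (suc i) m ++ segment x k n) (sym (+-suc i m))))

segment-suc : ∀ x i n → segment x i (suc n) ≡ segment x i n ++ [ x (i + n) ]
segment-suc x i n = trans (cong (segment x i) (+-comm 1 n)) (segment-+ x i n 1)

take-segment : ∀ x i n → take n (segment x i (suc n)) ≡ segment x i n
take-segment x i zero    = refl
take-segment x i (suc n) = cong (x i ∷_) (take-segment x (suc i) n)

shift : InfWord → InfWord
shift x j = x (suc j)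

segment-shift : ∀ x i n → segment (shift x) i n ≡ segment x (suc i) n
segment-shift x i zero    = refl
segment-shift x i (suc n) = cong (x (suc i) ∷_) (segment-shift x (suc i) n)

InfFactor : InfWord → ℕ → Word → Set
InfFactor x n v = ∃[ i ] segment x i n ≡ v

RightSpecialInf : InfWord → ℕ → Word → Set
RightSpecialInf x n u = InfFactor x (suc n) (u ++ [ a ]) × InfFactor x (suc n) (u ++ [ b ])

LeftSpecialInf : InfWord → ℕ → Word → Set
LeftSpecialInf x n u = InfFactor x (suc n) (a ∷ u) × InfFactor x (suc n) (b ∷ u)

rightExtension : ∀ x n {z} → InfFactor x n z → Σ Letter λ c → InfFactor x (suc n) (z ++ [ c ])
rightExtension x n (i , refl) = x (i + n) , i , segment-suc x i n

-- Every word
-- satisfying Q has a chosen extension satisfying P; a word r is branching when both of its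
-- extensions satisfy P.  Extending Λ and adding the second extension of every branching
-- word of R yields length R + length Λ distinct words satisfying P.
module Extensions (ext : Letter → Word → Word)
                  (ext-injective : ∀ {c c' z z'} → ext c z ≡ ext c' z' → c ≡ c' × z ≡ z')
                  (Q P : Word → Set)
                  (extend : ∀ {z} → Q z → Σ Letter λ c → P (ext c z)) where

  Branching : Word → Set
  Branching r = P (ext a r) × P (ext b r)

  OneExtension : List Word → Word → Set
  OneExtension Y z = ∀ {c c'} → ext c z ∈ Y → ext c' z ∈ Y → c ≡ c'

  extendAll : ∀ {Λ} → All Q Λ → List Word
  extendAll []                = []
  extendAll {z ∷ _} (qz ∷ qs) = ext (proj₁ (extend qz)) z ∷ extendAll qs

  extendAll-length : ∀ {Λ} (qs : All Q Λ) → length (extendAll qs) ≡ length Λ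
  extendAll-length []       = refl
  extendAll-length (_ ∷ qs) = cong suc (extendAll-length qs)

  extendAll-P : ∀ {Λ} (qs : All Q Λ) {y} → y ∈ extendAll qs → P y
  extendAll-P (qz ∷ _)  (here refl) = proj₂ (extend qz)
  extendAll-P (_  ∷ qs) (there y∈)  = extendAll-P qs y∈

  extendAll-base : ∀ {Λ} (qs : All Q Λ) {c z} → ext c z ∈ extendAll qs → z ∈ Λ
  extendAll-base (_ ∷ _)  (here e)   = here (proj₂ (ext-injective e))
  extendAll-base (_ ∷ qs) (there y∈) = there (extendAll-base qs y∈)

  extendAll-one : ∀ {Λ} (qs : All Q Λ) → Unique Λ → ∀ z → OneExtension (extendAll qs) z
  extendAll-one (_ ∷ _)  _          z (here e)   (here e')  =
    trans (proj₁ (ext-injective e)) (sym (proj₁ (ext-injective e')))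
  extendAll-one (_ ∷ qs) (z∉Λ ∷ _)  z (here e)   (there y∈) =
    ⊥-elim (All.lookup z∉Λ (extendAll-base qs y∈) (sym (proj₂ (ext-injective e))))
  extendAll-one (_ ∷ qs) (z∉Λ ∷ _)  z (there y∈) (here e)   =
    ⊥-elim (All.lookup z∉Λ (extendAll-base qs y∈) (sym (proj₂ (ext-injective e))))
  extendAll-one (_ ∷ qs) (_ ∷ uΛ)   z (there y∈) (there y∈') = extendAll-one qs uΛ z y∈ y∈'

  extendAll-unique : ∀ {Λ} (qs : All Q Λ) → Unique Λ → Unique (extendAll qs)
  extendAll-unique []       []         = []
  extendAll-unique (_ ∷ qs) (z∉Λ ∷ uΛ) =
    All.tabulate (λ y∈ e → All.lookup z∉Λ (extendAll-base qs (subst (_∈ extendAll qs) (sym e) y∈)) refl)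
    ∷ extendAll-unique qs uΛ

  freshExtension : ∀ {Y r} → OneExtension Y r → Branching r → Σ Letter λ c → P (ext c r) × ext c r ∉ Y
  freshExtension {Y} {r} one (pa , pb) with ext a r ∈? Y
  ... | no  a∉Y = a , pa , a∉Y
  ... | yes a∈Y = b , pb , λ b∈Y → a≢b (one a∈Y b∈Y)

  branchingCount : ∀ {m R} → AtLeast m Q → Unique R → All Branching R → AtLeast (length R + m) P
  branchingCount (Λ , uΛ , refl , QΛ) uR bs =
    let (Y , uY , lenY , PY , _) = grow uR bs in Y , uY , lenY , PY
    where
      qs : All Q Λ
      qs = All.tabulate QΛ

      -- The invariant: a duplicate-free list of P-words with at most one extension of each
      -- word not yet treated.
      grow : ∀ {R} → Unique R → All Branching R →
             Σ (List Word) λ Y → Unique Y × length Y ≡ length R + length Λ × (∀ {y} → y ∈ Y → P y) ×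
                                 (∀ {z} → z ∉ R → OneExtension Y z)
      grow [] [] = extendAll qs , extendAll-unique qs uΛ , extendAll-length qs , extendAll-P qs ,
                   λ {z} _ → extendAll-one qs uΛ z
      grow {r ∷ R} (r∉R ∷ uR) (br ∷ bs) with grow uR bs
      ... | Y , uY , lenY , PY , oneY with freshExtension (oneY (All¬⇒¬Any r∉R)) br
      ... | c , pc , c∉Y =
        ext c r ∷ Y ,
        All.tabulate (λ y∈Y e → c∉Y (subst (_∈ Y) (sym e) y∈Y)) ∷ uY ,
        cong suc lenY ,
        (λ { (here refl) → pc ; (there y∈Y) → PY y∈Y }) ,
        one
        where
          one : ∀ {z} → z ∉ r ∷ R → OneExtension (ext c r ∷ Y) z
          one z∉ (here e)  _          = ⊥-elim (z∉ (here (proj₂ (ext-injective e))))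
          one z∉ (there _) (here e)   = ⊥-elim (z∉ (here (proj₂ (ext-injective e))))
          one z∉ (there y∈) (there y∈') = oneY (z∉ ∘ there) y∈ y∈'

-- Right extensions of the factors of length n of an infinite word; 'Branching' is
-- RightSpecialInf x n.
module RightExtensions (x : InfWord) (n : ℕ) =
  Extensions (λ c z → z ++ [ c ]) snoc-injective (InfFactor x n) (InfFactor x (suc n)) (rightExtension x n)

-- An infinite word with a right special factor of length n has at least n + 2 factors of
-- length n + 1: every suffix of the right special factor is right special too, so each
-- length gains a factor.
rightSpecial⇒manyFactors : ∀ y {n} s → length s ≡ n → RightSpecialInf y n s →
                           AtLeast (2 + n) (InfFactor y (suc n))
rightSpecial⇒manyFactors y [] refl br =
  branchingCount {R = [ [] ]} ([ [] ] , [] ∷ [] , refl , λ { (here refl) → 0 , refl }) ([] ∷ []) (br ∷ [])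
  where open RightExtensions y 0
rightSpecial⇒manyFactors y (c ∷ s) refl br@((i , ea) , (j , eb)) =
  branchingCount {R = [ c ∷ s ]} (rightSpecial⇒manyFactors y s refl tailSpecial) ([] ∷ []) (br ∷ [])
  where
    open RightExtensions y (suc (length s))

    tailSpecial : RightSpecialInf y (length s) s
    tailSpecial = (suc i , ∷-injectiveʳ ea) , (suc j , ∷-injectiveʳ eb)

module SturmianWord (x : InfWord) (sturmian : SturmianInf x) where

  factors : ℕ → List Word
  factors n = proj₁ (sturmian n)

  length-factors : ∀ n → length (factors n) ≡ suc n
  length-factors n = proj₁ (proj₂ (sturmian n))

  factors-unique : ∀ n → Unique (factors n)
  factors-unique n = proj₁ (proj₂ (proj₂ (sturmian n)))

  factors-spec : ∀ n v → v ∈ factors n ⇔ (∃[ i ] window x i n ≡ v)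
  factors-spec n = proj₂ (proj₂ (proj₂ (sturmian n)))

  ∈factors⇒ : ∀ {n v} → v ∈ factors n → InfFactor x n v
  ∈factors⇒ {n} {v} v∈ = let (i , e) = Equivalence.to (factors-spec n v) v∈ in i , trans (sym (window≡segment x i n)) e

  ⇒∈factors : ∀ {n v} → InfFactor x n v → v ∈ factors n
  ⇒∈factors {n} {v} (i , e) = Equivalence.from (factors-spec n v) (i , trans (window≡segment x i n) e)

  factors-atLeast : ∀ n → AtLeast (suc n) (InfFactor x n)
  factors-atLeast n = factors n , factors-unique n , length-factors n , ∈factors⇒

  tooMany : ∀ {n} → ¬ AtLeast (3 + n) (InfFactor x (suc n))
  tooMany {n} many = n≮n _ (subst (3 + n ≤_) (length-factors (suc n)) (atLeast-bound many ⇒∈factors))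

  rightSpecial-unique : ∀ n {u v} → u ≢ v → RightSpecialInf x n u → RightSpecialInf x n v → ⊥
  rightSpecial-unique n u≢v bu bv =
    tooMany (branchingCount (factors-atLeast n) ((u≢v ∷ []) ∷ [] ∷ []) (bu ∷ bv ∷ []))
    where open RightExtensions x n

  -- Every prefix of x occurs again.  Otherwise the shifted word y would have n + 1 factors
  -- of length n + 1 and no right special factor of length n, hence n + 1 factors of length
  -- n, all different from the prefix of length n: too many for x.
  prefix-recurs : ∀ n → ¬ ¬ (∃[ j ] segment x (suc j) n ≡ segment x 0 n)
  prefix-recurs n noReturn = n≮n _ (subst (suc (suc n) ≤_) (length-factors n) fewShort)
    where
      y : InfWord
      y = shift x

      prefix : ℕ → Word
      prefix = segment x 0

      prefix∈factors : ∀ m → prefix m ∈ factors m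
      prefix∈factors m = ⇒∈factors (0 , refl)

      y⊆x : ∀ {m v} → InfFactor y m v → v ∈ factors m
      y⊆x {m} (j , e) = ⇒∈factors (suc j , trans (sym (segment-shift x j m)) e)

      x⊆y : ∀ {m v} → v ∈ factors m → v ≢ prefix m → InfFactor y m v
      x⊆y {m} v∈ v≢prefix with ∈factors⇒ v∈
      ... | zero  , e = ⊥-elim (v≢prefix (sym e))
      ... | suc j , e = j , trans (segment-shift x j m) e

      prefix-absent : ¬ InfFactor y n (prefix n)
      prefix-absent (j , e) = noReturn (j , trans (sym (segment-shift x j n)) e)

      prefix-absent-suc : ¬ InfFactor y (suc n) (prefix (suc n))
      prefix-absent-suc (j , e) =
        prefix-absent (j , trans (sym (take-segment y j n)) (trans (cong (take n) e) (take-segment x 0 n)))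

      -- y has at most n + 1 factors of length n + 1, hence no right special factor of length n.
      noRightSpecial : ∀ s → length s ≡ n → ¬ RightSpecialInf y n s
      noRightSpecial s |s|≡n br =
        n≮n _ (subst (3 + n ≤_) (length-factors (suc n))
                 (atLeast-bound-missing (rightSpecial⇒manyFactors y s |s|≡n br) y⊆x
                                        (prefix∈factors (suc n)) prefix-absent-suc))

      -- Without right special factors, a factor is determined by its first n letters.
      take-injective : ∀ {p q} → InfFactor y (suc n) p → InfFactor y (suc n) q → take n p ≡ take n q → p ≡ q
      take-injective (i , refl) (j , refl) e =
        sameLastLetter (trans (sym (take-segment y i n)) (trans e (take-segment y j n)))
        where
          s = segment y i n

          sameLastLetter : s ≡ segment y j n → segment y i (suc n) ≡ segment y j (suc n)
          sameLastLetter s≡s' with y (i + n) ≟ᴸ y (j + n)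
          ... | yes c≡c' = trans (segment-suc y i n)
                             (trans (cong₂ (λ t c → t ++ [ c ]) s≡s' c≡c') (sym (segment-suc y j n)))
          ... | no c≢c'  =
            ⊥-elim (noRightSpecial s (length-segment y i n)
                     (bothLetters (λ c → InfFactor y (suc n) (s ++ [ c ])) c≢c'
                       (i , segment-suc y i n) (j , trans (segment-suc y j n) (cong (_++ [ y (j + n) ]) (sym s≡s')))))

      take-factor : ∀ {p} → InfFactor y (suc n) p → InfFactor y n (take n p)
      take-factor (i , refl) = i , sym (take-segment y i n)

      many : AtLeast (suc n) (InfFactor y (suc n))
      many = Λ , uΛ , suc-injective (trans (without-length (factors-unique (suc n)) (prefix∈factors (suc n))) (length-factors (suc n))) ,
             λ v∈Λ → let (v∈ , v≢prefix) = without-member v∈Λ in x⊆y v∈ v≢prefix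
        where
          Λ = factors (suc n) without prefix (suc n)
          uΛ = filter⁺ (λ z → ¬? (z ≟ᵂ prefix (suc n))) (factors-unique (suc n))

      -- So y has n + 1 factors of length n, none of them the prefix of x: x would have n + 2.
      fewShort : suc (suc n) ≤ length (factors n)
      fewShort = atLeast-bound-missing (atLeast-map (take n) take-injective take-factor many) y⊆x
                                       (prefix∈factors n) prefix-absent

  leftExtension : ∀ {n j} → segment x (suc j) n ≡ segment x 0 n →
                  ∀ {z} → InfFactor x n z → Σ Letter λ c → InfFactor x (suc n) (c ∷ z)
  leftExtension {j = j} return (zero  , e) = x j , j , cong (x j ∷_) (trans return e)
  leftExtension         _      (suc i , e) = x i , i , cong (x i ∷_) e

  module LeftExtensions (n j : ℕ) (return : segment x (suc j) n ≡ segment x 0 n) =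
    Extensions _∷_ ∷-injective (InfFactor x n) (InfFactor x (suc n)) (leftExtension return)

  leftSpecial-unique : ∀ n {u v} → u ≢ v → LeftSpecialInf x n u → LeftSpecialInf x n v → ⊥
  leftSpecial-unique n u≢v bu bv = prefix-recurs n λ (j , return) →
    tooMany (LeftExtensions.branchingCount n j return (factors-atLeast n) ((u≢v ∷ []) ∷ [] ∷ []) (bu ∷ bv ∷ []))

segment-factor : ∀ x i w → segment x i (length w) ≡ w → ∀ {v} → Factor v w → InfFactor x (length v) v
segment-factor x i w segment≡w {v} (_ , xs , ys , refl , e) = j , sym v≡segment
  where
    j = i + length xs

    |w| : length w ≡ length xs + (length v + length ys)
    |w| = trans (cong length (sym e)) (trans (length-++ xs) (cong (length xs +_) (length-++ v)))

    split : xs ++ v ++ ys ≡ segment x i (length xs) ++ segment x j (length v) ++ segment x (j + length v) (length ys)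
    split = trans e (trans (sym segment≡w) (trans (cong (segment x i) |w|)
              (trans (segment-+ x i (length xs) _) (cong (segment x i (length xs) ++_) (segment-+ x j (length v) _)))))

    v≡segment : v ≡ segment x j (length v)
    v≡segment = proj₁ (++-split v (segment x j (length v)) (sym (length-segment x j (length v)))
                         (proj₂ (++-split xs (segment x i (length xs)) (sym (length-segment x i (length xs))) split)))

RightSpecialUnique : Word → Set
RightSpecialUnique w = ∀ {u v} → RightSpecial w u → RightSpecial w v → length u ≡ length v → u ≡ v

LeftSpecialUnique : Word → Set
LeftSpecialUnique w = ∀ {u v} → LeftSpecial w u → LeftSpecial w v → length u ≡ length v → u ≡ v

uniquePerLength : ∀ {T : Word → Set} → (∀ {u v} → T u → T v → length u ≡ length v → ¬ u ≢ v) →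
                  ∀ {u v} → u ≡ [] ⊎ T u → v ≡ [] ⊎ T v → length u ≡ length v → u ≡ v
uniquePerLength _    (inj₁ refl) (inj₁ refl) _ = refl
uniquePerLength _    (inj₁ refl) (inj₂ _)    l = sym (empty-by-length (sym l))
uniquePerLength _    (inj₂ _)    (inj₁ refl) l = empty-by-length l
uniquePerLength same (inj₂ tu)   (inj₂ tv)   l = decidable-stable (_ ≟ᵂ _) (same tu tv l)

-- Factors of a Sturmian word are factors of a Sturmian infinite word, which has at most
-- one right and one left special factor of each length.
sturmian⇒rightSpecialUnique : ∀ {w} → Sturmian w → RightSpecialUnique w
sturmian⇒rightSpecialUnique {w} (x , sturmian , i , window≡w) = uniquePerLength distinct
  where
    open SturmianWord x sturmian

    rightInf : ∀ {u} c → Factor (u ++ [ c ]) w → InfFactor x (suc (length u)) (u ++ [ c ])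
    rightInf {u} c f = subst (λ k → InfFactor x k (u ++ [ c ])) (length-snoc u c)
                         (segment-factor x i w (trans (sym (window≡segment x i (length w))) window≡w) f)

    distinct : ∀ {u v} → Factor (u ++ [ a ]) w × Factor (u ++ [ b ]) w →
               Factor (v ++ [ a ]) w × Factor (v ++ [ b ]) w → length u ≡ length v → ¬ u ≢ v
    distinct {u} {v} (ua , ub) (va , vb) l u≢v =
      rightSpecial-unique (length u) u≢v (rightInf a ua , rightInf b ub)
        (subst (λ k → RightSpecialInf x k v) (sym l) (rightInf a va , rightInf b vb))

sturmian⇒leftSpecialUnique : ∀ {w} → Sturmian w → LeftSpecialUnique w
sturmian⇒leftSpecialUnique {w} (x , sturmian , i , window≡w) = uniquePerLength distinct
  where
    open SturmianWord x sturmian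

    leftInf : ∀ {u} → Factor u w → InfFactor x (length u) u
    leftInf = segment-factor x i w (trans (sym (window≡segment x i (length w))) window≡w)

    distinct : ∀ {u v} → Factor (a ∷ u) w × Factor (b ∷ u) w →
               Factor (a ∷ v) w × Factor (b ∷ v) w → length u ≡ length v → ¬ u ≢ v
    distinct {u} {v} (ua , ub) (va , vb) l u≢v =
      leftSpecial-unique (length u) u≢v (leftInf ua , leftInf ub)
        (subst (λ k → LeftSpecialInf x k v) (sym l) (leftInf va , leftInf vb))

occurs-bound : ∀ {v u i} → OccursAt v u i → i + length v ≤ length u
occurs-bound {v} (xs , ys , refl , refl) = subst (length xs + length v ≤_) (sym (length-++₃ xs v ys)) (m≤m+n _ _)

prefix? : (v t : Word) → Dec (∃[ s ] v ++ s ≡ t)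
prefix? []      t       = yes (t , refl)
prefix? (c ∷ v) []      = no λ ()
prefix? (c ∷ v) (d ∷ t) with c ≟ᴸ d | prefix? v t
... | yes refl | yes (s , e) = yes (s , cong (c ∷_) e)
... | yes refl | no ¬pre     = no λ { (s , e) → ¬pre (s , ∷-injectiveʳ e) }
... | no c≢d   | _           = no λ { (s , e) → c≢d (∷-injectiveˡ e) }

occurs? : ∀ v u i → Dec (OccursAt v u i)
occurs? v u i with i ≤? length u
... | no i≰|u| = no λ o → i≰|u| (≤-trans (m≤m+n i (length v)) (occurs-bound o))
... | yes i≤|u| with prefix? v (drop i u)
...   | yes (ys , e) = yes (take i u , ys , trans (length-take i u) (m≤n⇒m⊓n≡m i≤|u|) ,
                            trans (cong (take i u ++_) e) (take++drop≡id i u))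
...   | no ¬pre = no λ { (xs , ys , refl , e) →
                      ¬pre (ys , trans (sym (drop-length-++ xs _)) (cong (drop (length xs)) e)) }

occurs-followed : ∀ {v u i} → OccursAt v u i → i + length v < length u →
                  Σ Letter λ d → OccursAt (v ++ [ d ]) u i
occurs-followed {v} (xs , []     , refl , e) inside =
  ⊥-elim (<-irrefl (sym (trans (cong length (sym e)) (trans (length-++₃ xs v []) (+-identityʳ _)))) inside)
occurs-followed {v} (xs , d ∷ ys , |xs|≡i , e) _ =
  d , xs , ys , |xs|≡i , trans (cong (xs ++_) (++-assoc v [ d ] ys)) e

occursOnce-self : ∀ u → OccursOnce u u
occursOnce-self u = (0 , [] , [] , refl , ++-identityʳ u) , λ i j oi oj → trans (at0 oi) (sym (at0 oj))
  where
    at0 : ∀ {i} → OccursAt u u i → i ≡ 0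
    at0 {i} o = n≤0⇒n≡0 (+-cancelʳ-≤ (length u) i 0 (occurs-bound o))

occurs-tail : ∀ {c t w i} → OccursAt (c ∷ t) w i → OccursAt t w (suc i)
occurs-tail {c} {t} (xs , ys , refl , e) = xs ++ [ c ] , ys , length-snoc xs c , trans (++-assoc xs [ c ] (t ++ ys)) e

Suffix : Word → Word → Set
Suffix v t = ∃[ s ] s ++ v ≡ t

factor-suffix : ∀ {s t w} → Factor (s ++ t) w → Factor t w
factor-suffix {s} {t} (i , xs , ys , |xs|≡i , e) =
  i + length s , xs ++ s , ys , trans (length-++ xs) (cong (_+ length s) |xs|≡i) ,
  trans (++-assoc xs s (t ++ ys)) (trans (cong (xs ++_) (sym (++-assoc s t ys))) e)

rightSpecial-suffix : ∀ {w t v} → RightSpecial w t → Suffix v t → RightSpecial w v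
rightSpecial-suffix {v = []}    _           _            = inj₁ refl
rightSpecial-suffix {v = _ ∷ _} (inj₁ refl) ([] , ())
rightSpecial-suffix {v = _ ∷ _} (inj₁ refl) (_ ∷ _ , ())
rightSpecial-suffix {w} {v = v} (inj₂ (fa , fb)) (s , refl) =
  inj₂ (factor-suffix {s} (subst (λ z → Factor z w) (++-assoc s v [ a ]) fa) ,
        factor-suffix {s} (subst (λ z → Factor z w) (++-assoc s v [ b ]) fb))

suffix-of-length : ∀ n (t : Word) → n ≤ length t → Σ Word λ v → Suffix v t × length v ≡ n
suffix-of-length n t n≤|t| =
  drop (length t ∸ n) t , (take (length t ∸ n) t , take++drop≡id (length t ∸ n) t) ,
  trans (length-drop (length t ∸ n) t) (m∸[m∸n]≡n n≤|t|)

suffixes : Word → List Word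
suffixes []      = [ [] ]
suffixes (c ∷ p) = (c ∷ p) ∷ suffixes p

length-suffixes : ∀ p → length (suffixes p) ≡ suc (length p)
length-suffixes []      = refl
length-suffixes (c ∷ p) = cong suc (length-suffixes p)

∈suffixes⇒ : ∀ {v} p → v ∈ suffixes p → Suffix v p
∈suffixes⇒ []      (here refl) = [] , refl
∈suffixes⇒ (c ∷ p) (here refl) = [] , refl
∈suffixes⇒ (c ∷ p) (there v∈)  = let (s , e) = ∈suffixes⇒ p v∈ in c ∷ s , cong (c ∷_) e

⇒∈suffixes : ∀ {v} p → Suffix v p → v ∈ suffixes p
⇒∈suffixes []      ([] , refl)    = here refl
⇒∈suffixes (c ∷ p) ([] , refl)    = here refl
⇒∈suffixes (c ∷ p) (d ∷ s , e)    = there (⇒∈suffixes p (s , ∷-injectiveʳ e))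

suffix-length : ∀ {v t} → Suffix v t → length v ≤ length t
suffix-length {v} (s , refl) = subst (length v ≤_) (sym (length-++ s)) (m≤n+m _ _)

-- The suffixes of p have distinct lengths, so they are distinct.
suffixes-unique : ∀ p → Unique (suffixes p)
suffixes-unique []      = [] ∷ []
suffixes-unique (c ∷ p) =
  All.tabulate (λ v∈ e → n≮n _ (subst (λ z → length z ≤ length p) (sym e) (suffix-length (∈suffixes⇒ p v∈))))
  ∷ suffixes-unique p

-- A decomposition w = p c r in which p c occurs only at position 0 but p occurs twice;
-- p c is then the shortest prefix of w occurring once (see H-decomposition).
module ShortestUnrepeatedPrefix {w p r : Word} {c : Letter} (w≡pcr : w ≡ p ++ c ∷ r)
         (pc-once : ∀ i → OccursAt (p ++ [ c ]) w i → i ≡ 0) (p-repeated : ¬ OccursOnce p w) where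

  p-at-0 : OccursAt p w 0
  p-at-0 = [] , c ∷ r , refl , sym w≡pcr

  pc-at-0 : OccursAt (p ++ [ c ]) w 0
  pc-at-0 = [] , r , refl , trans (++-assoc p [ c ] r) (sym w≡pcr)

  -- An occurrence of p after position 0 and before the end is followed by a letter other
  -- than c, so p is right special.
  interior⇒rightSpecial : ∀ {i} → OccursAt p w (suc i) → suc i + length p < length w → RightSpecial w p
  interior⇒rightSpecial o inside with occurs-followed o inside
  ... | d , pd-occurs with d ≟ᴸ c
  ...   | yes refl = ⊥-elim (1+n≢0 (pc-once _ pd-occurs))
  ...   | no d≢c   = inj₂ (bothLetters (λ e → Factor (p ++ [ e ]) w) d≢c (_ , pd-occurs) (0 , pc-at-0))

  Interior : Set
  Interior = ∃[ i ] i < length w × (OccursAt p w (suc i) × suc i + length p < length w)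

  atEnds : ¬ Interior → ∀ i → OccursAt p w i → i ≡ 0 ⊎ i ≡ length w ∸ length p
  atEnds _          zero    _ = inj₁ refl
  atEnds noInterior (suc i) o = inj₂ (trans (sym (m+n∸n≡m (suc i) (length p))) (cong (_∸ length p) ends))
    where
      ends : suc i + length p ≡ length w
      ends = ≤-antisym (occurs-bound o) (≮⇒≥ λ inside →
               noInterior (i , ≤-trans (m≤m+n (suc i) (length p)) (occurs-bound o) , o , inside))

  -- Hence, since p occurs twice, w is closed with border p.
  noInterior⇒closed : p ≢ [] → ¬ Interior → Closed w
  noInterior⇒closed p≢[] noInterior with occurs? p w (length w ∸ length p)
  ... | yes atEnd   = inj₂ (p , p≢[] , subst (_≤ length w) (length-snoc p c) (occurs-bound pc-at-0) ,
                            p-at-0 , atEnd , atEnds noInterior)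
  ... | no notAtEnd = ⊥-elim (p-repeated ((0 , p-at-0) , λ i j oi oj → trans (only0 oi) (sym (only0 oj))))
    where
      only0 : ∀ {i} → OccursAt p w i → i ≡ 0
      only0 {i} o with atEnds noInterior i o
      ... | inj₁ i≡0   = i≡0
      ... | inj₂ i≡end = ⊥-elim (notAtEnd (subst (OccursAt p w) i≡end o))

  p-rightSpecial : Open w → RightSpecial w p
  p-rightSpecial isOpen
    with p ≟ᵂ [] | anyUpTo? (λ i → occurs? p w (suc i) ×-dec (suc i + length p <? length w)) (length w)
  ... | yes p≡[] | _                            = inj₁ p≡[]
  ... | no _     | yes (_ , _ , o , inside)     = interior⇒rightSpecial o inside
  ... | no p≢[]  | no noInterior                = ⊥-elim (isOpen (noInterior⇒closed p≢[] noInterior))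

  module _ (unique : RightSpecialUnique w) (pRS : RightSpecial w p) where

    -- No right special factor is longer than p: the one of length |p| + 1 would end with
    -- p, so p a and p b would both occur after position 0, one of them being p c.
    rightSpecial-short : ∀ {v} → RightSpecial w v → length v ≤ length p
    rightSpecial-short {v} vRS with length v ≤? length p
    ... | yes short = short
    ... | no long with suffix-of-length (suc (length p)) v (≰⇒> long)
    ...   | d ∷ t , t-suffix , |dt| with rightSpecial-suffix vRS t-suffix
    ...     | inj₂ ((i , oa) , (j , ob)) = ⊥-elim (1+n≢0 (pc-once _ (proj₂ (everyLetter PLater later-a later-b c))))
      where
        t≡p : t ≡ p
        t≡p = unique (rightSpecial-suffix (rightSpecial-suffix vRS t-suffix) ([ d ] , refl)) pRS (suc-injective |dt|)

        PLater : Letter → Set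
        PLater e = ∃[ k ] OccursAt (p ++ [ e ]) w (suc k)

        later-a : PLater a
        later-a = i , subst (λ z → OccursAt (z ++ [ a ]) w (suc i)) t≡p (occurs-tail oa)

        later-b : PLater b
        later-b = j , subst (λ z → OccursAt (z ++ [ b ]) w (suc j)) t≡p (occurs-tail ob)

    rightSpecial⇒suffix : ∀ {v} → RightSpecial w v → Suffix v p
    rightSpecial⇒suffix {v} vRS =
      let (t , t-suffix , |t|) = suffix-of-length (length v) p (rightSpecial-short vRS)
      in subst (λ z → Suffix z p) (unique (rightSpecial-suffix pRS t-suffix) vRS |t|) t-suffix

    rightSpecial-count : ∀ {SR} → Enumerates (RightSpecial w) SR → length SR ≡ suc (length p)
    rightSpecial-count (uSR , SR⇔) =
      trans (sameLength uSR (suffixes-unique p)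
                        (λ v∈ → ⇒∈suffixes p (rightSpecial⇒suffix (Equivalence.to (SR⇔ _) v∈)))
                        (λ v∈ → Equivalence.from (SR⇔ _) (rightSpecial-suffix pRS (∈suffixes⇒ p v∈))))
            (length-suffixes p)

splitAt-letter : ∀ n (w : Word) → n < length w →
                 Σ Word λ p → Σ Letter λ c → Σ Word λ r → w ≡ p ++ c ∷ r × length p ≡ n
splitAt-letter zero    (c ∷ w) _         = [] , c , w , refl , refl
splitAt-letter (suc n) (d ∷ w) (s≤s n<w) =
  let (p , c , r , w≡pcr , |p|≡n) = splitAt-letter n w n<w in d ∷ p , c , r , cong (d ∷_) w≡pcr , cong suc |p|≡n

take-letter : ∀ (p : Word) c r → take (suc (length p)) (p ++ c ∷ r) ≡ p ++ [ c ]
take-letter p c r = trans (cong₂ take (sym (length-snoc p c)) (sym (∷ʳ-++ p c r))) (take-length-++ (p ++ [ c ]) r)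

H-decomposition : ∀ {w h} → w ≢ [] → IsH w h →
                  Σ Word λ p → Σ Letter λ c → Σ Word λ r → w ≡ p ++ c ∷ r × h ≡ suc (length p) ×
                  (∀ i → OccursAt (p ++ [ c ]) w i → i ≡ 0) × ¬ OccursOnce p w
H-decomposition {[]}            w≢[] _ = ⊥-elim (w≢[] refl)
H-decomposition {d ∷ w} {zero}  _    ((_ , once) , _) =
  ⊥-elim (1+n≢0 (once 1 0 ([ d ] , w , refl , refl) ([] , d ∷ w , refl , refl)))
H-decomposition {w}     {suc h} _    (once , shorter) with splitAt-letter h w h<|w|
  where
    -- w itself occurs once, so H_w ≤ |w|.
    h<|w| : h < length w
    h<|w| = ≮⇒≥ λ |w|<1+h → shorter (length w) |w|<1+h
              (subst (λ z → OccursOnce z w) (sym (take-all (length w) w ≤-refl)) (occursOnce-self w))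
... | p , c , r , refl , refl = p , c , r , refl , refl , pc-once , p-repeated
  where
    pc-once : ∀ i → OccursAt (p ++ [ c ]) (p ++ c ∷ r) i → i ≡ 0
    pc-once i o = proj₂ (subst (λ z → OccursOnce z (p ++ c ∷ r)) (take-letter p c r) once) i 0 o
                        ([] , r , refl , ++-assoc p [ c ] r)

    p-repeated : ¬ OccursOnce p (p ++ c ∷ r)
    p-repeated p-once = shorter (length p) ≤-refl
                          (subst (λ z → OccursOnce z (p ++ c ∷ r)) (sym (take-length-++ p (c ∷ r))) p-once)

rightSpecialCount : ∀ {w h SR} → w ≢ [] → Open w → RightSpecialUnique w → IsH w h →
                    Enumerates (RightSpecial w) SR → length SR ≡ h
rightSpecialCount w≢[] isOpen unique isH enum with H-decomposition w≢[] isH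
... | p , c , r , w≡pcr , refl , pc-once , p-repeated =
  rightSpecial-count unique (p-rightSpecial isOpen) enum
  where open ShortestUnrepeatedPrefix w≡pcr pc-once p-repeated

-- Reflecting the position i of a factor of length m in a word of length n.
mirror : ℕ → ℕ → ℕ → ℕ
mirror n m i = n ∸ (i + m)

mirror-involutive : ∀ {n m i} → i + m ≤ n → mirror n m (mirror n m i) ≡ i
mirror-involutive {n} {m} {i} i+m≤n = begin
  n ∸ (n ∸ (i + m) + m)   ≡⟨ sym (∸-+-assoc n (n ∸ (i + m)) m) ⟩
  n ∸ (n ∸ (i + m)) ∸ m   ≡⟨ cong (_∸ m) (m∸[m∸n]≡n i+m≤n) ⟩
  i + m ∸ m               ≡⟨ m+n∸n≡m i m ⟩
  i                       ∎
  where open ≡-Reasoning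

occurs-reverse : ∀ {v u i} → OccursAt v u i → OccursAt (reverse v) (reverse u) (mirror (length u) (length v) i)
occurs-reverse {v} (xs , ys , refl , refl) = reverse ys , reverse xs , |ys| , sym reversed
  where
    |ys| : length (reverse ys) ≡ length (xs ++ v ++ ys) ∸ (length xs + length v)
    |ys| = trans (length-reverse ys) (sym (trans (cong (_∸ (length xs + length v)) (length-++₃ xs v ys))
                                                  (m+n∸m≡n (length xs + length v) (length ys))))

    reversed : reverse (xs ++ v ++ ys) ≡ reverse ys ++ reverse v ++ reverse xs
    reversed = trans (reverse-++ xs (v ++ ys))
                 (trans (cong (_++ reverse xs) (reverse-++ v ys)) (++-assoc (reverse ys) (reverse v) (reverse xs)))

occurs-reverse⁻ : ∀ {v u j} → OccursAt (reverse v) (reverse u) j → OccursAt v u (mirror (length u) (length v) j)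
occurs-reverse⁻ {v} {u} {j} o =
  subst₂ (λ v' u' → OccursAt v' u' (mirror (length u) (length v) j)) (reverse-involutive v) (reverse-involutive u)
    (subst₂ (λ n m → OccursAt (reverse (reverse v)) (reverse (reverse u)) (mirror n m j))
            (length-reverse u) (length-reverse v) (occurs-reverse o))

mirror-reverse : ∀ {v u j} → OccursAt (reverse v) (reverse u) j →
                 mirror (length u) (length v) (mirror (length u) (length v) j) ≡ j
mirror-reverse {v} {u} o =
  mirror-involutive (subst₂ (λ m n → _ + m ≤ n) (length-reverse v) (length-reverse u) (occurs-bound o))

factor-reverse : ∀ {v u} → Factor v u → Factor (reverse v) (reverse u)
factor-reverse (_ , o) = _ , occurs-reverse o

occursOnce-reverse : ∀ {v u} → OccursOnce v u → OccursOnce (reverse v) (reverse u)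
occursOnce-reverse {v} {u} (f , once) = factor-reverse f , λ i j oi oj →
  trans (sym (mirror-reverse {v} {u} oi))
        (trans (cong (mirror (length u) (length v)) (once _ _ (occurs-reverse⁻ {v} {u} oi) (occurs-reverse⁻ {v} {u} oj)))
               (mirror-reverse {v} {u} oj))

closed-reverse : ∀ {u} → Closed u → Closed (reverse u)
closed-reverse {u} (inj₁ |u|≡1)                          = inj₁ (trans (length-reverse u) |u|≡1)
closed-reverse {u} (inj₂ (v , v≢[] , |v|<|u| , at0 , atEnd , atEnds)) =
  inj₂ (reverse v , rev≢[] , subst₂ _<_ (sym (length-reverse v)) (sym (length-reverse u)) |v|<|u| ,
        subst (OccursAt (reverse v) (reverse u)) (mirror-involutive (<⇒≤ |v|<|u|)) (occurs-reverse atEnd) ,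
        subst (OccursAt (reverse v) (reverse u)) end (occurs-reverse at0) ,
        λ j o → ends j o (atEnds _ (occurs-reverse⁻ {v} {u} o)))
  where
    rev≢[] : reverse v ≢ []
    rev≢[] e = v≢[] (trans (sym (reverse-involutive v)) (cong reverse e))

    end : length u ∸ length v ≡ length (reverse u) ∸ length (reverse v)
    end = sym (cong₂ _∸_ (length-reverse u) (length-reverse v))

    ends : ∀ j → OccursAt (reverse v) (reverse u) j →
           mirror (length u) (length v) j ≡ 0 ⊎ mirror (length u) (length v) j ≡ length u ∸ length v →
           j ≡ 0 ⊎ j ≡ length (reverse u) ∸ length (reverse v)
    ends j o (inj₁ m≡0)   = inj₂ (trans (sym (mirror-reverse {v} {u} o)) (trans (cong (mirror _ _) m≡0) end))
    ends j o (inj₂ m≡end) = inj₁ (trans (sym (mirror-reverse {v} {u} o))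
                              (trans (cong (mirror _ _) m≡end) (mirror-involutive (<⇒≤ |v|<|u|))))

open-reverse : ∀ {w} → Open w → Open (reverse w)
open-reverse {w} isOpen closed = isOpen (subst Closed (reverse-involutive w) (closed-reverse closed))

take-reverse : ∀ k (w : Word) → k ≤ length w → take k (reverse w) ≡ reverse (drop (length w ∸ k) w)
take-reverse k w k≤|w| = begin
  take k (reverse w)                          ≡⟨ cong (take k ∘ reverse) (sym (take++drop≡id (length w ∸ k) w)) ⟩
  take k (reverse (front ++ back))            ≡⟨ cong (take k) (reverse-++ front back) ⟩
  take k (reverse back ++ reverse front)      ≡⟨ cong (λ n → take n (reverse back ++ reverse front)) (sym |back|) ⟩
  take (length (reverse back)) (reverse back ++ reverse front) ≡⟨ take-length-++ (reverse back) (reverse front) ⟩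
  reverse back                                ∎
  where
    open ≡-Reasoning
    front = take (length w ∸ k) w
    back  = drop (length w ∸ k) w
    |back| : length (reverse back) ≡ k
    |back| = trans (length-reverse back) (trans (length-drop (length w ∸ k) w) (m∸[m∸n]≡n k≤|w|))

isK⇒isH-reverse : ∀ {w k} → IsK w k → IsH (reverse w) k
isK⇒isH-reverse {w} {k} (once , shorter) =
  subst (λ z → OccursOnce z (reverse w)) (sym (take-reverse k w k≤|w|)) (occursOnce-reverse once) ,
  λ j j<k once' → shorter j j<k
    (subst₂ OccursOnce (reverse-involutive _) (reverse-involutive w)
      (occursOnce-reverse (subst (λ z → OccursOnce z (reverse w)) (take-reverse j w (<⇒≤ (<-≤-trans j<k k≤|w|))) once')))
  where
    -- w itself occurs once, so K_w ≤ |w|.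
    k≤|w| : k ≤ length w
    k≤|w| = ≮⇒≥ λ |w|<k → shorter (length w) |w|<k
              (subst (λ z → OccursOnce z w) (cong (λ n → drop n w) (sym (n∸n≡0 (length w)))) (occursOnce-self w))

leftSpecial⇒reverse : ∀ {w v} → LeftSpecial w v → RightSpecial (reverse w) (reverse v)
leftSpecial⇒reverse (inj₁ refl) = inj₁ refl
leftSpecial⇒reverse {w} {v} (inj₂ (fa , fb)) =
  inj₂ (subst (λ z → Factor z (reverse w)) (unfold-reverse a v) (factor-reverse fa) ,
        subst (λ z → Factor z (reverse w)) (unfold-reverse b v) (factor-reverse fb))

reverse⇒leftSpecial : ∀ {w v} → RightSpecial (reverse w) v → LeftSpecial w (reverse v)
reverse⇒leftSpecial (inj₁ refl) = inj₁ refl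
reverse⇒leftSpecial {w} {v} (inj₂ (fa , fb)) = inj₂ (unreverse a fa , unreverse b fb)
  where
    unreverse : ∀ c → Factor (v ++ [ c ]) (reverse w) → Factor (c ∷ reverse v) w
    unreverse c f = subst₂ Factor (reverse-++ v [ c ]) (reverse-involutive w) (factor-reverse f)

leftSpecialUnique⇒reverse : ∀ {w} → LeftSpecialUnique w → RightSpecialUnique (reverse w)
leftSpecialUnique⇒reverse {w} unique {u} {v} uRS vRS |u|≡|v| =
  reverse-injective (unique (reverse⇒leftSpecial {w} uRS) (reverse⇒leftSpecial {w} vRS)
    (trans (length-reverse u) (trans |u|≡|v| (sym (length-reverse v)))))

enumerates-reverse : ∀ {w SL} → Enumerates (LeftSpecial w) SL → Enumerates (RightSpecial (reverse w)) (map reverse SL)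
enumerates-reverse {w} {SL} (uSL , SL⇔) = map⁺ reverse-injective uSL , λ v → mk⇔ (to v) (from v)
  where
    to : ∀ v → v ∈ map reverse SL → RightSpecial (reverse w) v
    to v v∈ with ∈-map⁻ reverse v∈
    ... | t , t∈ , refl = leftSpecial⇒reverse (Equivalence.to (SL⇔ t) t∈)

    from : ∀ v → RightSpecial (reverse w) v → v ∈ map reverse SL
    from v vRS = subst (_∈ map reverse SL) (reverse-involutive v)
                   (∈-map⁺ reverse (Equivalence.from (SL⇔ (reverse v)) (reverse⇒leftSpecial vRS)))

leftSpecialCount : ∀ {w k SL} → w ≢ [] → Open w → LeftSpecialUnique w → IsK w k →
                   Enumerates (LeftSpecial w) SL → length SL ≡ k
leftSpecialCount {w} {SL = SL} w≢[] isOpen unique isK enum =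
  trans (sym (length-map reverse SL))
        (rightSpecialCount rev≢[] (open-reverse isOpen) (leftSpecialUnique⇒reverse unique)
                           (isK⇒isH-reverse isK) (enumerates-reverse enum))
  where
    rev≢[] : reverse w ≢ []
    rev≢[] e = w≢[] (trans (sym (reverse-involutive w)) (cong reverse e))

lemma8 : (w : Word) → w ≢ [] → Sturmian w → Open w →
         (h k : ℕ) → IsH w h → IsK w k →
         (SL SR : List Word) →
         Enumerates (LeftSpecial w) SL → Enumerates (RightSpecial w) SR →
         length SL ≡ k × length SR ≡ h
lemma8 w w≢[] sturmian isOpen h k isH isK SL SR enumL enumR =
  leftSpecialCount w≢[] isOpen (sturmian⇒leftSpecialUnique sturmian) isK enumL ,
  rightSpecialCount w≢[] isOpen (sturmian⇒rightSpecialUnique sturmian) isH enumR
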